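{- (i) For every context $\Gamma$: if $\Gamma\ \mathrm{ok}_s$ then $\Gamma\ \mathrm{ok}$. (ii) For every context $\Gamma$ and terms $M,A$: if $\Gamma\vdash_s M:A$ then $\Gamma\vdash M:A$.
   Context: Variables $\mathcal{V}$: a type with decidable equality and maps $\mathrm{encode}:\mathcal{V}\to\mathbb{N}$, $\mathrm{decode}:\mathbb{N}\to\mathcal{V}$ with $\mathrm{encode}(\mathrm{decode}\,n)=n$. Constants $\mathcal{C}$: any type. Terms: $\mathsf{c}\,k$, $\mathsf{v}\,x$, $\lambda[x:A]M$, $\Pi[x:A]B$, $M\cdot N$. Free-variable list: $\mathrm{fv}(\mathsf{c}\,k)=[\,]$, $\mathrm{fv}(\mathsf{v}\,x)=[x]$, $\mathrm{fv}(\lambda[x:A]M)=\mathrm{fv}\,A\mathbin{++}(\mathrm{fv}\,M-x)$, likewise $\Pi$, $\mathrm{fv}(M\cdot N)=\mathrm{fv}\,M\mathbin{++}\mathrm{fv}\,N$ ($xs-x$ removes all occurrences of $x$). Substitutions $\sigma:\mathcal{V}\to\Lambda$; $\iota\,x=\mathsf{v}\,x$; $(\sigma,x:=N)$ sends $x$ to $N$, $y\neq x$ to $\sigma\,y$. Fix $\chi':\mathrm{List}\,\mathbb{N}\to\mathbb{N}$ with $\chi'(ns)\notin ns$; $X'(xs)=\mathrm{decode}(\chi'(\mathrm{map\ encode}\ xs))$; $X(\sigma,xs)=X'$(concatenation of $\mathrm{fv}(\sigma\,y)$ for $y$ in $xs$). Substitution: $\mathsf{c}\,k\bullet\sigma=\mathsf{c}\,k$,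 $\mathsf{v}\,x\bullet\sigma=\sigma\,x$, $(M\cdot N)\bullet\sigma=(M\bullet\sigma)\cdot(N\bullet\sigma)$, $(\lambda[x:A]M)\bullet\sigma=\lambda[y:A\bullet\sigma](M\bullet(\sigma,x:=\mathsf{v}\,y))$ with $y=X(\sigma,\mathrm{fv}\,M-x)$, analogously for $\Pi$ (with $y=X(\sigma,\mathrm{fv}\,B-x)$). $M[x:=N]=M\bullet(\iota,x:=N)$. Alpha-conversion $\sim_\alpha$: inductive, $\mathsf{c}\,k\sim_\alpha\mathsf{c}\,k$, $\mathsf{v}\,x\sim_\alpha\mathsf{v}\,x$, congruence for application, and $\lambda[x:A]M\sim_\alpha\lambda[x':A']M'$ whenever $A\sim_\alpha A'$, $y\notin\mathrm{fv}\,M-x$, $y\notin\mathrm{fv}\,M'-x'$ and $M[x:=\mathsf{v}\,y]=M'[x':=\mathsf{v}\,y]$ syntactically, for some $y$ (same for $\Pi$). Beta: the contextual closure of a relation $S$ is the least relation containing $S$ and closed under rewriting in the body or annotation of $\lambda$, in the codomain or domain of $\Pi$, and in either side of an application; $\to_\beta$ is the contextual closure of $(\lambda[x:A]M)\cdot N\ \triangleright\ M[x:=N]$; $\simeq_\beta$ is the reflexive–symmetric–transitive closure of $\sim_\alpha\cup\to_\beta$. PTS: fix $\mathcal{A}\subseteq\mathcal{C}^2$ (axioms) and $\mathcal{R}\subseteq\mathcal{C}^3$ (rules). A context is a list of pairs $(x,A)$; $\Gamma,x:A$ denotes $(x,A)::\Gamma$; $\mathrm{dom}\,\Gamma$ is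 the list of first components. Infinitary system: the judgments $\Gamma\ \mathrm{ok}$ and $\Gamma\vdash M:A$ are mutually inductively defined by: (nil) $[\,]\ \mathrm{ok}$; (cons) if $\Gamma\ \mathrm{ok}$, $\Gamma\vdash A:\mathsf{c}\,s$ and $x\notin\mathrm{dom}\,\Gamma$ then $(\Gamma,x:A)\ \mathrm{ok}$; (sort) if $\Gamma\ \mathrm{ok}$ and $\mathcal{A}\,s_1\,s_2$ then $\Gamma\vdash\mathsf{c}\,s_1:\mathsf{c}\,s_2$; (prod) if $\Gamma\vdash A:\mathsf{c}\,s_1$, for every $y\notin\mathrm{dom}\,\Gamma$ we have $\Gamma,y:A\vdash B[x:=\mathsf{v}\,y]:\mathsf{c}\,s_2$, and $\mathcal{R}\,s_1\,s_2\,s_3$, then $\Gamma\vdash\Pi[x:A]B:\mathsf{c}\,s_3$; (var) if $\Gamma\ \mathrm{ok}$ and $(x,A)\in\Gamma$ then $\Gamma\vdash\mathsf{v}\,x:A$; (abs) if $\Gamma\vdash A:\mathsf{c}\,s_1$, for every $z\notin\mathrm{dom}\,\Gamma$ both $\Gamma,z:A\vdash B[y:=\mathsf{v}\,z]:\mathsf{c}\,s_2$ and $\Gamma,z:A\vdash M[x:=\mathsf{v}\,z]:B[y:=\mathsf{v}\,z]$, and $\mathcal{R}\,s_1\,s_2\,s_3$, then $\Gamma\vdash\lambda[x:A]M:\Pi[y:A]B$; (app) if $\Gamma\vdash M:\Pi[x:A]B$, $\Gamma\vdash N:A$ and $\Gamma\vdash B[x:=N]:\mathsf{c}\,s$, then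 $\Gamma\vdash M\cdot N:B[x:=N]$; (conv) if $\Gamma\vdash M:A$, $A\simeq_\beta B$ and $\Gamma\vdash B:\mathsf{c}\,s$ then $\Gamma\vdash M:B$. Standard (finitary) system: $\Gamma\ \mathrm{ok}_s$ and $\Gamma\vdash_s M:A$ are mutually inductively defined by: (nil) $[\,]\ \mathrm{ok}_s$; (cons) if $\Gamma\ \mathrm{ok}_s$, $\Gamma\vdash_s A:\mathsf{c}\,s$ and $x\notin\mathrm{dom}\,\Gamma$ then $(\Gamma,x:A)\ \mathrm{ok}_s$; (sort) if $\Gamma\ \mathrm{ok}_s$ and $\mathcal{A}\,s_1\,s_2$ then $\Gamma\vdash_s\mathsf{c}\,s_1:\mathsf{c}\,s_2$; (prod) if $\Gamma\vdash_s A:\mathsf{c}\,s_1$, $\Gamma,y:A\vdash_s B[x:=\mathsf{v}\,y]:\mathsf{c}\,s_2$, $\mathcal{R}\,s_1\,s_2\,s_3$ and $y\notin\mathrm{fv}\,B-x$, then $\Gamma\vdash_s\Pi[x:A]B:\mathsf{c}\,s_3$; (var) if $\Gamma\ \mathrm{ok}_s$ and $(x,A)\in\Gamma$ then $\Gamma\vdash_s\mathsf{v}\,x:A$; (abs) if $\Gamma\vdash_s A:\mathsf{c}\,s_1$, $\Gamma,z:A\vdash_s B[y:=\mathsf{v}\,z]:\mathsf{c}\,s_2$, $\Gamma,z:A\vdash_s M[x:=\mathsf{v}\,z]:B[y:=\mathsf{v}\,z]$, $\mathcal{R}\,s_1\,s_2\,s_3$, $z\notin\mathrm{fv}\,M-x$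 and $z\notin\mathrm{fv}\,B-y$, then $\Gamma\vdash_s\lambda[x:A]M:\Pi[y:A]B$; (app) if $\Gamma\vdash_s M:\Pi[x:A]B$ and $\Gamma\vdash_s N:A$ then $\Gamma\vdash_s M\cdot N:B[x:=N]$; (conv) if $\Gamma\vdash_s M:A$, $A\simeq_\beta B$ and $\Gamma\vdash_s B:\mathsf{c}\,s$ then $\Gamma\vdash_s M:B$. -}

module Defs where

open import Data.Nat using (ℕ)
open import Data.List using (List; []; _∷_; _++_; map; filter; concatMap)
open import Data.List.Membership.Propositional using (_∈_; _∉_)
open import Data.Product using (_×_; _,_; proj₁)
open import Relation.Binary.Definitions using (DecidableEquality)
open import Relation.Binary.PropositionalEquality using (_≡_; _≢_)
open import Relation.Nullary using (¬_; Dec; yes; no)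
open import Relation.Nullary.Decidable using (¬?)

record Params : Set₁ where
  field
    V       : Set
    _≟V_    : DecidableEquality V
    encode  : V → ℕ
    decode  : ℕ → V
    enc-dec : ∀ n → encode (decode n) ≡ n
    C       : Set
    χ'      : List ℕ → ℕ
    χ'-fresh : ∀ ns → χ' ns ∉ ns
    Ax      : C → C → Set
    Rl      : C → C → C → Set

module System (P : Params) where
  open Params P

  data Term : Set where
    c   : C → Term
    v   : V → Term
    lam : V → Term → Term → Term       -- λ[x:A]M  as  lam x A M
    pi  : V → Term → Term → Term       -- Π[x:A]B  as  pi x A B
    _·_ : Term → Term → Term

  _-_ : List V → V → List V
  xs - x = filter (λ y → ¬? (y ≟V x)) xs

  fv : Term → List V
  fv (c k) = []
  fv (v x) = x ∷ []
  fv (lam x A M) = fv A ++ (fv M - x)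
  fv (pi x A B) = fv A ++ (fv B - x)
  fv (M · N) = fv M ++ fv N

  Subst : Set
  Subst = V → Term

  ι : Subst
  ι x = v x

  _⟨_≔_⟩ : Subst → V → Term → Subst
  (σ ⟨ x ≔ N ⟩) y with y ≟V x
  ... | yes _ = N
  ... | no  _ = σ y

  X' : List V → V
  X' xs = decode (χ' (map encode xs))

  X : Subst → List V → V
  X σ xs = X' (concatMap (λ y → fv (σ y)) xs)

  _•_ : Term → Subst → Term
  c k • σ = c k
  v x • σ = σ x
  (M · N) • σ = (M • σ) · (N • σ)
  lam x A M • σ =
    let y = X σ (fv M - x) in lam y (A • σ) (M • (σ ⟨ x ≔ v y ⟩))
  pi x A B • σ =
    let y = X σ (fv B - x) in pi y (A • σ) (B • (σ ⟨ x ≔ v y ⟩))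

  -- (σ, x := N) is written  σ ⟨ x ≔ N ⟩ ;  M [ x ≔ N ]
  infixl 30 _[_≔_]
  _[_≔_] : Term → V → Term → Term
  M [ x ≔ N ] = M • (ι ⟨ x ≔ N ⟩)

  data _∼α_ : Term → Term → Set where
    α-c   : ∀ k → c k ∼α c k
    α-v   : ∀ x → v x ∼α v x
    α-app : ∀ {M M' N N'} → M ∼α M' → N ∼α N' → (M · N) ∼α (M' · N')
    α-lam : ∀ {x x' A A' M M'} y → A ∼α A' → y ∉ fv M - x → y ∉ fv M' - x' →
            M [ x ≔ v y ] ≡ M' [ x' ≔ v y ] → lam x A M ∼α lam x' A' M'
    α-pi  : ∀ {x x' A A' B B'} y → A ∼α A' → y ∉ fv B - x → y ∉ fv B' - x' →
            B [ x ≔ v y ] ≡ B' [ x' ≔ v y ] → pi x A B ∼α pi x' A' B'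

  data Ctx (S : Term → Term → Set) : Term → Term → Set where
    base   : ∀ {M N} → S M N → Ctx S M N
    lam-body : ∀ {x A M M'} → Ctx S M M' → Ctx S (lam x A M) (lam x A M')
    lam-ann  : ∀ {x A A' M} → Ctx S A A' → Ctx S (lam x A M) (lam x A' M)
    pi-cod   : ∀ {x A B B'} → Ctx S B B' → Ctx S (pi x A B) (pi x A B')
    pi-dom   : ∀ {x A A' B} → Ctx S A A' → Ctx S (pi x A B) (pi x A' B)
    app-l    : ∀ {M M' N} → Ctx S M M' → Ctx S (M · N) (M' · N)
    app-r    : ∀ {M N N'} → Ctx S N N' → Ctx S (M · N) (M · N')

  data _▷β_ : Term → Term → Set where
    β : ∀ {x A M N} → (lam x A M · N) ▷β (M [ x ≔ N ])

  _→β_ : Term → Term → Set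
  _→β_ = Ctx _▷β_

  data _≃β_ : Term → Term → Set where
    step-α : ∀ {M N} → M ∼α N → M ≃β N
    step-β : ∀ {M N} → M →β N → M ≃β N
    ≃-refl  : ∀ {M} → M ≃β M
    ≃-sym   : ∀ {M N} → M ≃β N → N ≃β M
    ≃-trans : ∀ {M N K} → M ≃β N → N ≃β K → M ≃β K

  Context : Set
  Context = List (V × Term)

  dom : Context → List V
  dom = map proj₁

  -- infinitary system
  infix 4 _⊢_∶_ _⊢ₛ_∶_
  mutual
    data Ok : Context → Set where
      ok-nil  : Ok []
      ok-cons : ∀ {Γ x A s} → Ok Γ → Γ ⊢ A ∶ c s → x ∉ dom Γ → Ok ((x , A) ∷ Γ)

    data _⊢_∶_ : Context → Term → Term → Set where
      t-sort : ∀ {Γ s₁ s₂} → Ok Γ → Ax s₁ s₂ → Γ ⊢ c s₁ ∶ c s₂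
      t-prod : ∀ {Γ x A B s₁ s₂ s₃} → Γ ⊢ A ∶ c s₁ →
               (∀ y → y ∉ dom Γ → ((y , A) ∷ Γ) ⊢ B [ x ≔ v y ] ∶ c s₂) →
               Rl s₁ s₂ s₃ → Γ ⊢ pi x A B ∶ c s₃
      t-var  : ∀ {Γ x A} → Ok Γ → (x , A) ∈ Γ → Γ ⊢ v x ∶ A
      t-abs  : ∀ {Γ x y A B M s₁ s₂ s₃} → Γ ⊢ A ∶ c s₁ →
               (∀ z → z ∉ dom Γ → ((z , A) ∷ Γ) ⊢ B [ y ≔ v z ] ∶ c s₂) →
               (∀ z → z ∉ dom Γ → ((z , A) ∷ Γ) ⊢ M [ x ≔ v z ] ∶ B [ y ≔ v z ]) →
               Rl s₁ s₂ s₃ → Γ ⊢ lam x A M ∶ pi y A B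
      t-app  : ∀ {Γ M N x A B s} → Γ ⊢ M ∶ pi x A B → Γ ⊢ N ∶ A →
               Γ ⊢ B [ x ≔ N ] ∶ c s → Γ ⊢ M · N ∶ B [ x ≔ N ]
      t-conv : ∀ {Γ M A B s} → Γ ⊢ M ∶ A → A ≃β B → Γ ⊢ B ∶ c s → Γ ⊢ M ∶ B

  mutual
    data Okₛ : Context → Set where
      ok-nil  : Okₛ []
      ok-cons : ∀ {Γ x A s} → Okₛ Γ → Γ ⊢ₛ A ∶ c s → x ∉ dom Γ → Okₛ ((x , A) ∷ Γ)

    data _⊢ₛ_∶_ : Context → Term → Term → Set where
      t-sort : ∀ {Γ s₁ s₂} → Okₛ Γ → Ax s₁ s₂ → Γ ⊢ₛ c s₁ ∶ c s₂
      t-prod : ∀ {Γ x y A B s₁ s₂ s₃} → Γ ⊢ₛ A ∶ c s₁ →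
               ((y , A) ∷ Γ) ⊢ₛ B [ x ≔ v y ] ∶ c s₂ →
               Rl s₁ s₂ s₃ → y ∉ fv B - x → Γ ⊢ₛ pi x A B ∶ c s₃
      t-var  : ∀ {Γ x A} → Okₛ Γ → (x , A) ∈ Γ → Γ ⊢ₛ v x ∶ A
      t-abs  : ∀ {Γ x y z A B M s₁ s₂ s₃} → Γ ⊢ₛ A ∶ c s₁ →
               ((z , A) ∷ Γ) ⊢ₛ B [ y ≔ v z ] ∶ c s₂ →
               ((z , A) ∷ Γ) ⊢ₛ M [ x ≔ v z ] ∶ B [ y ≔ v z ] →
               Rl s₁ s₂ s₃ → z ∉ fv M - x → z ∉ fv B - y →
               Γ ⊢ₛ lam x A M ∶ pi y A B
      t-app  : ∀ {Γ M N x A B} → Γ ⊢ₛ M ∶ pi x A B → Γ ⊢ₛ N ∶ A →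
               Γ ⊢ₛ M · N ∶ B [ x ≔ N ]
      t-conv : ∀ {Γ M A B s} → Γ ⊢ₛ M ∶ A → A ≃β B → Γ ⊢ₛ B ∶ c s → Γ ⊢ₛ M ∶ B

module Submission where

-- The standard product and abstraction rules
-- check the body at a single fresh name y, the infinitary ones at every fresh name z; the gap is
-- bridged by a substitution lemma for the infinitary system, applied to the renaming y ↦ z. The
-- infinitary application rule moreover needs Γ ⊢ B[x:=N] : s, which follows from validity of the
-- type Π[x:A]B of the function, inversion of the product rule, and the same substitution lemma.
-- Because substitution renames bound variables, that lemma only holds up to α-conversion; α-classes
-- are represented by the canonical forms M • ι, and ≃β is shown to be stable under substitution.

open import Defs
open import Data.List using (List; []; _∷_; _++_; map; concat; concatMap)
open import Data.List.Properties using (++-identityʳ; concatMap-++; concatMap-pure; map-cong-local; filter-reject; filter-all)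
import Data.List.Effectful as List
open import Data.List.Membership.Propositional using (_∈_; _∉_; find; lose)
open import Data.List.Membership.Propositional.Properties
  using (∈-map⁺; ∈-++⁺ˡ; ∈-++⁺ʳ; ∈-++⁻; ∈-filter⁺; ∈-filter⁻; ∈-concatMap⁺; ∈-concatMap⁻)
open import Data.List.Relation.Unary.Any using (here; there)
open import Data.List.Relation.Binary.Subset.Propositional using (_⊆_)
open import Data.List.Relation.Binary.Subset.Propositional.Properties using (++⁺ˡ; ++⁺ʳ; map⁺; ∷⁺ʳ)
import Data.List.Relation.Unary.All as All
open import Data.Product using (_×_; _,_; proj₁; proj₂; ∃-syntax)
open import Data.Sum using (_⊎_; inj₁; inj₂)
open import Data.Empty using (⊥-elim)
open import Function using (_∘_)
open import Relation.Binary.PropositionalEquality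
open import Relation.Nullary using (yes; no)
open import Relation.Nullary.Decidable using (¬?)

concatMap-cong-local : ∀ {A B : Set} {f g : A → List B} L →
                       (∀ {u} → u ∈ L → f u ≡ g u) → concatMap f L ≡ concatMap g L
concatMap-cong-local L eq = cong concat (map-cong-local (All.tabulate eq))

cong₃ : ∀ {A B C D : Set} (f : A → B → C → D) {a a' b b' c c'} →
        a ≡ a' → b ≡ b' → c ≡ c' → f a b c ≡ f a' b' c'
cong₃ f refl refl refl = refl

module Metatheory (P : Params) where
  open Params P
  open System P

  -- Substitution on raw terms

  update-here : ∀ σ x N → (σ ⟨ x ≔ N ⟩) x ≡ N
  update-here σ x N with x ≟V x
  ... | yes _ = refl
  ... | no x≢x = ⊥-elim (x≢x refl)

  update-there : ∀ σ x N {y} → y ≢ x → (σ ⟨ x ≔ N ⟩) y ≡ σ y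
  update-there σ x N {y} y≢x with y ≟V x
  ... | yes y≡x = ⊥-elim (y≢x y≡x)
  ... | no _ = refl

  update-cong : ∀ {σ τ : Subst} {x N N' u} → N ≡ N' → (u ≢ x → σ u ≡ τ u) →
                (σ ⟨ x ≔ N ⟩) u ≡ (τ ⟨ x ≔ N' ⟩) u
  update-cong {x = x} {u = u} N≡N' σu≡τu with u ≟V x
  ... | yes _ = N≡N'
  ... | no u≢x = σu≡τu u≢x

  ∈-minus⁺ : ∀ {u x} L → u ∈ L → u ≢ x → u ∈ L - x
  ∈-minus⁺ {x = x} L = ∈-filter⁺ (λ y → ¬? (y ≟V x))

  ∈-minus⁻ : ∀ {u x} L → u ∈ L - x → u ∈ L × u ≢ x
  ∈-minus⁻ {x = x} L = ∈-filter⁻ (λ y → ¬? (y ≟V x))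

  minus-self : ∀ x L → (x ∷ L) - x ≡ L - x
  minus-self x L = filter-reject (λ y → ¬? (y ≟V x)) (λ x≢x → x≢x refl)

  minus-∉ : ∀ x L → x ∉ L → L - x ≡ L
  minus-∉ x L x∉L = filter-all (λ y → ¬? (y ≟V x))
    (All.tabulate (λ u∈L u≡x → x∉L (subst (_∈ L) u≡x u∈L)))

  minus-++ : ∀ x L₁ L₂ → (L₁ ++ L₂) - x ≡ (L₁ - x) ++ (L₂ - x)
  minus-++ x [] L₂ = refl
  minus-++ x (y ∷ L₁) L₂ with y ≟V x
  ... | yes _ = minus-++ x L₁ L₂
  ... | no _ = cong (y ∷_) (minus-++ x L₁ L₂)

  fv[_] : Subst → List V → List V
  fv[ σ ] = concatMap (λ u → fv (σ u))

  fv[ι] : ∀ L → fv[ ι ] L ≡ L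
  fv[ι] = concatMap-pure

  X'-fresh : ∀ L → X' L ∉ L
  X'-fresh L m = χ'-fresh (map encode L) (subst (_∈ map encode L) (enc-dec _) (∈-map⁺ encode m))

  X-fresh : ∀ σ L {u} → u ∈ L → X σ L ∉ fv (σ u)
  X-fresh σ L u∈L y∈σu = X'-fresh (fv[ σ ] L) (∈-concatMap⁺ (fv ∘ σ) (lose u∈L y∈σu))

  -- `lam x A M • σ` unfolds to `lam (binder σ x M) (A • σ) (body σ x M)`, and likewise for `pi`.
  binder : Subst → V → Term → V
  binder σ x M = X σ (fv M - x)

  body : Subst → V → Term → Term
  body σ x M = M • (σ ⟨ x ≔ v (binder σ x M) ⟩)

  Fresh : V → Subst → List V → Set
  Fresh y σ L = ∀ {u} → u ∈ L → y ∉ fv (σ u)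

  fv[update]-minus : ∀ σ x y L → Fresh y σ (L - x) →
                     fv[ σ ⟨ x ≔ v y ⟩ ] L - y ≡ fv[ σ ] (L - x)
  fv[update]-minus σ x y [] _ = refl
  fv[update]-minus σ x y (u ∷ L) y# with u ≟V x
  ... | yes _ = trans (minus-self y _) (fv[update]-minus σ x y L y#)
  ... | no _ = trans (minus-++ y (fv (σ u)) _)
                 (cong₂ _++_ (minus-∉ y (fv (σ u)) (y# (here refl))) (fv[update]-minus σ x y L (y# ∘ there)))

  mutual
    fv-• : ∀ M σ → fv (M • σ) ≡ fv[ σ ] (fv M)
    fv-• (c k) σ = refl
    fv-• (v x) σ = sym (++-identityʳ (fv (σ x)))
    fv-• (M · N) σ = trans (cong₂ _++_ (fv-• M σ) (fv-• N σ)) (sym (concatMap-++ _ (fv M) (fv N)))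
    fv-• (lam x A M) σ = trans (cong₂ _++_ (fv-• A σ) (fv-body M x σ)) (sym (concatMap-++ _ (fv A) (fv M - x)))
    fv-• (pi x A B) σ = trans (cong₂ _++_ (fv-• A σ) (fv-body B x σ)) (sym (concatMap-++ _ (fv A) (fv B - x)))

    fv-rebind : ∀ M x σ y → Fresh y σ (fv M - x) → fv (M • (σ ⟨ x ≔ v y ⟩)) - y ≡ fv[ σ ] (fv M - x)
    fv-rebind M x σ y y# = trans (cong (_- y) (fv-• M _)) (fv[update]-minus σ x y (fv M) y#)

    fv-body : ∀ M x σ → fv (body σ x M) - binder σ x M ≡ fv[ σ ] (fv M - x)
    fv-body M x σ = fv-rebind M x σ _ (X-fresh σ (fv M - x))

  binder-cong : ∀ M x {σ τ} → (∀ {u} → u ∈ fv M - x → σ u ≡ τ u) → binder σ x M ≡ binder τ x M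
  binder-cong M x eq = cong X' (concatMap-cong-local (fv M - x) (cong fv ∘ eq))

  mutual
    •-cong : ∀ M {σ τ} → (∀ {u} → u ∈ fv M → σ u ≡ τ u) → M • σ ≡ M • τ
    •-cong (c k) eq = refl
    •-cong (v x) eq = eq (here refl)
    •-cong (M · N) eq = cong₂ _·_ (•-cong M (eq ∘ ∈-++⁺ˡ)) (•-cong N (eq ∘ ∈-++⁺ʳ (fv M)))
    •-cong (lam x A M) eq =
      cong₃ lam (binder-cong M x (eq ∘ ∈-++⁺ʳ (fv A))) (•-cong A (eq ∘ ∈-++⁺ˡ)) (body-cong M x (eq ∘ ∈-++⁺ʳ (fv A)))
    •-cong (pi x A B) eq =
      cong₃ pi (binder-cong B x (eq ∘ ∈-++⁺ʳ (fv A))) (•-cong A (eq ∘ ∈-++⁺ˡ)) (body-cong B x (eq ∘ ∈-++⁺ʳ (fv A)))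

    body-cong : ∀ M x {σ τ} → (∀ {u} → u ∈ fv M - x → σ u ≡ τ u) → body σ x M ≡ body τ x M
    body-cong M x eq = •-cong M (λ {u} u∈M →
      update-cong (cong v (binder-cong M x eq)) (λ u≢x → eq (∈-minus⁺ (fv M) u∈M u≢x)))

  •-update-∉ : ∀ T σ x N → x ∉ fv T → T • (σ ⟨ x ≔ N ⟩) ≡ T • σ
  •-update-∉ T σ x N x∉T = •-cong T (λ {u} u∈T → update-there σ x N (λ u≡x → x∉T (subst (_∈ fv T) u≡x u∈T)))

  _⨾_ : Subst → Subst → Subst
  (σ ⨾ τ) u = σ u • τ

  binder-⨾ : ∀ M x σ τ → binder τ (binder σ x M) (body σ x M) ≡ binder (σ ⨾ τ) x M
  binder-⨾ M x σ τ = cong X' (begin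
    fv[ τ ] (fv (body σ x M) - binder σ x M)         ≡⟨ cong fv[ τ ] (fv-body M x σ) ⟩
    fv[ τ ] (fv[ σ ] (fv M - x))                     ≡⟨ List.MonadProperties.associative (fv M - x) _ _ ⟨
    concatMap (λ u → fv[ τ ] (fv (σ u))) (fv M - x)  ≡⟨ concatMap-cong-local (fv M - x) (λ {u} _ → fv-• (σ u) τ) ⟨
    fv[ σ ⨾ τ ] (fv M - x)                           ∎)
    where open ≡-Reasoning

  mutual
    •-⨾ : ∀ M σ τ → (M • σ) • τ ≡ M • (σ ⨾ τ)
    •-⨾ (c k) σ τ = refl
    •-⨾ (v x) σ τ = refl
    •-⨾ (M · N) σ τ = cong₂ _·_ (•-⨾ M σ τ) (•-⨾ N σ τ)
    •-⨾ (lam x A M) σ τ = cong₃ lam (binder-⨾ M x σ τ) (•-⨾ A σ τ) (body-⨾ M x σ τ)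
    •-⨾ (pi x A B) σ τ = cong₃ pi (binder-⨾ B x σ τ) (•-⨾ A σ τ) (body-⨾ B x σ τ)

    body-⨾ : ∀ M x σ τ → body τ (binder σ x M) (body σ x M) ≡ body (σ ⨾ τ) x M
    body-⨾ M x σ τ = trans (•-⨾ M _ _) (•-cong M (λ {u} → pointwise u))
      where
      y = binder σ x M
      pointwise : ∀ u → u ∈ fv M → ((σ ⟨ x ≔ v y ⟩) u) • (τ ⟨ y ≔ v (binder τ y (body σ x M)) ⟩)
                                   ≡ ((σ ⨾ τ) ⟨ x ≔ v (binder (σ ⨾ τ) x M) ⟩) u
      pointwise u u∈M with u ≟V x
      ... | yes _ = trans (update-here τ y _) (cong v (binder-⨾ M x σ τ))
      ... | no u≢x = •-update-∉ (σ u) τ y _ (X-fresh σ (fv M - x) (∈-minus⁺ (fv M) u∈M u≢x))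

  •-rename : ∀ M {x y} σ N → y ∉ fv M - x → M • (σ ⟨ x ≔ N ⟩) ≡ (M [ x ≔ v y ]) • (σ ⟨ y ≔ N ⟩)
  •-rename M {x} {y} σ N y∉M = sym (trans (•-⨾ M _ _) (•-cong M (λ {u} → pointwise u)))
    where
    pointwise : ∀ u → u ∈ fv M → ((ι ⟨ x ≔ v y ⟩) u) • (σ ⟨ y ≔ N ⟩) ≡ (σ ⟨ x ≔ N ⟩) u
    pointwise u u∈M with u ≟V x
    ... | yes _ = update-here σ y N
    ... | no u≢x = update-there σ y N (λ u≡y → y∉M (subst (_∈ fv M - x) u≡y (∈-minus⁺ (fv M) u∈M u≢x)))

  -- Substitution renames every binder to a name determined by the free variables of its body,
  -- so `M • ι` is a canonical representative of the α-class of M (∼α⇒⌊⌋≡, ⌊⌋≡⇒∼α).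
  ⌊_⌋ : Term → Term
  ⌊ M ⌋ = M • ι

  Normal : Subst → Set
  Normal σ = ∀ u → ⌊ σ u ⌋ ≡ σ u

  ι-normal : Normal ι
  ι-normal _ = refl

  update-normal : ∀ {σ} x {N} → Normal σ → ⌊ N ⌋ ≡ N → Normal (σ ⟨ x ≔ N ⟩)
  update-normal x σ-normal N-normal u with u ≟V x
  ... | yes _ = N-normal
  ... | no _ = σ-normal u

  rename-normal : ∀ x y → Normal (ι ⟨ x ≔ v y ⟩)
  rename-normal x y = update-normal x ι-normal refl

  ⌊•⌋ : ∀ M {σ} → Normal σ → ⌊ M • σ ⌋ ≡ M • σ
  ⌊•⌋ M σ-normal = trans (•-⨾ M _ ι) (•-cong M (λ {u} _ → σ-normal u))

  ⌊⌊⌋⌋ : ∀ M → ⌊ ⌊ M ⌋ ⌋ ≡ ⌊ M ⌋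
  ⌊⌊⌋⌋ M = ⌊•⌋ M ι-normal

  •-resp-⌊⌋ : ∀ {M N} σ → ⌊ M ⌋ ≡ ⌊ N ⌋ → M • σ ≡ N • σ
  •-resp-⌊⌋ {M} {N} σ eq = trans (sym (•-⨾ M ι σ)) (trans (cong (_• σ) eq) (•-⨾ N ι σ))

  fv-⌊⌋ : ∀ M → fv ⌊ M ⌋ ≡ fv M
  fv-⌊⌋ M = trans (fv-• M ι) (fv[ι] (fv M))

  fv-resp-⌊⌋ : ∀ {M N} → ⌊ M ⌋ ≡ ⌊ N ⌋ → fv M ≡ fv N
  fv-resp-⌊⌋ {M} {N} eq = trans (sym (fv-⌊⌋ M)) (trans (cong fv eq) (fv-⌊⌋ N))

  binder-resp-⌊⌋ : ∀ {M N} σ x → ⌊ M ⌋ ≡ ⌊ N ⌋ → binder σ x M ≡ binder σ x N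
  binder-resp-⌊⌋ {M} {N} σ x eq = cong (λ L → X σ (L - x)) (fv-resp-⌊⌋ {M} {N} eq)

  body-resp-⌊⌋ : ∀ {M N} σ x → ⌊ M ⌋ ≡ ⌊ N ⌋ → body σ x M ≡ body σ x N
  body-resp-⌊⌋ {M} {N} σ x eq =
    trans (•-resp-⌊⌋ {M} {N} _ eq) (cong (λ y → N • (σ ⟨ x ≔ v y ⟩)) (binder-resp-⌊⌋ {M} {N} σ x eq))

  ∉⇒Fresh-ι : ∀ {y L} → y ∉ L → Fresh y ι L
  ∉⇒Fresh-ι y∉L u∈L (here refl) = y∉L u∈L

  fv-rename : ∀ M x y → y ∉ fv M - x → fv (M [ x ≔ v y ]) - y ≡ fv M - x
  fv-rename M x y y∉M = trans (fv-rebind M x ι y (∉⇒Fresh-ι y∉M)) (fv[ι] (fv M - x))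

  •-update-rename : ∀ M x σ {y} z → Normal σ → Fresh y σ (fv M - x) →
                    (M • (σ ⟨ x ≔ v y ⟩)) [ y ≔ v z ] ≡ M • (σ ⟨ x ≔ v z ⟩)
  •-update-rename M x σ {y} z σ-normal y# = trans (•-⨾ M _ _) (•-cong M (λ {u} → pointwise u))
    where
    pointwise : ∀ u → u ∈ fv M → ((σ ⟨ x ≔ v y ⟩) u) [ y ≔ v z ] ≡ (σ ⟨ x ≔ v z ⟩) u
    pointwise u u∈M with u ≟V x
    ... | yes _ = update-here ι y (v z)
    ... | no u≢x = trans (•-update-∉ (σ u) ι y (v z) (y# (∈-minus⁺ (fv M) u∈M u≢x))) (σ-normal u)

  binder-rebind : ∀ M x σ y → Fresh y σ (fv M - x) → binder ι y (M • (σ ⟨ x ≔ v y ⟩)) ≡ binder σ x M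
  binder-rebind M x σ y y# = cong X' (trans (fv[ι] _) (fv-rebind M x σ y y#))

  body-rebind : ∀ M x σ y → Normal σ → Fresh y σ (fv M - x) → body ι y (M • (σ ⟨ x ≔ v y ⟩)) ≡ body σ x M
  body-rebind M x σ y σ-normal y# =
    trans (•-update-rename M x σ _ σ-normal y#) (cong (λ z → M • (σ ⟨ x ≔ v z ⟩)) (binder-rebind M x σ y y#))

  binder-ι-∉ : ∀ M x → binder ι x M ∉ fv M - x
  binder-ι-∉ M x = X'-fresh _ ∘ subst (binder ι x M ∈_) (sym (fv[ι] (fv M - x)))

  instantiate-⌊⌋ : ∀ B' B {x' x σ} → binder ι x' B' ≡ binder σ x B → body ι x' B' ≡ body σ x B → Normal σ →
                   ∀ z → ⌊ B' [ x' ≔ v z ] ⌋ ≡ B • (σ ⟨ x ≔ v z ⟩)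
  instantiate-⌊⌋ B' B {x'} {x} {σ} binder≡ body≡ σ-normal z = begin
    ⌊ B' [ x' ≔ v z ] ⌋                       ≡⟨ ⌊•⌋ B' (rename-normal x' z) ⟩
    B' [ x' ≔ v z ]                           ≡⟨ •-rename B' ι (v z) (binder-ι-∉ B' x') ⟩
    body ι x' B' [ binder ι x' B' ≔ v z ]     ≡⟨ cong₂ (λ T y → T [ y ≔ v z ]) body≡ binder≡ ⟩
    body σ x B [ binder σ x B ≔ v z ]         ≡⟨ •-update-rename B x σ z σ-normal (X-fresh σ (fv B - x)) ⟩
    B • (σ ⟨ x ≔ v z ⟩)                       ∎
    where open ≡-Reasoning

  binder-α : ∀ M M' {x x'} y → y ∉ fv M - x → y ∉ fv M' - x' → M [ x ≔ v y ] ≡ M' [ x' ≔ v y ] →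
             binder ι x M ≡ binder ι x' M'
  binder-α M M' {x} {x'} y y∉M y∉M' eq = cong (X ι) (begin
    fv M - x                 ≡⟨ fv-rename M x y y∉M ⟨
    fv (M [ x ≔ v y ]) - y   ≡⟨ cong (λ T → fv T - y) eq ⟩
    fv (M' [ x' ≔ v y ]) - y ≡⟨ fv-rename M' x' y y∉M' ⟩
    fv M' - x'               ∎)
    where open ≡-Reasoning

  body-α : ∀ M M' {x x'} y → y ∉ fv M - x → y ∉ fv M' - x' → M [ x ≔ v y ] ≡ M' [ x' ≔ v y ] →
           body ι x M ≡ body ι x' M'
  body-α M M' {x} {x'} y y∉M y∉M' eq = begin
    M [ x ≔ v z ]                     ≡⟨ •-rename M ι (v z) y∉M ⟩
    (M [ x ≔ v y ]) [ y ≔ v z ]       ≡⟨ cong (_[ y ≔ v z ]) eq ⟩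
    (M' [ x' ≔ v y ]) [ y ≔ v z ]     ≡⟨ •-rename M' ι (v z) y∉M' ⟨
    M' [ x' ≔ v z ]                   ≡⟨ cong (λ w → M' [ x' ≔ v w ]) (binder-α M M' y y∉M y∉M' eq) ⟩
    M' [ x' ≔ v (binder ι x' M') ]    ∎
    where
    open ≡-Reasoning
    z = binder ι x M

  ∼α⇒⌊⌋≡ : ∀ {M N} → M ∼α N → ⌊ M ⌋ ≡ ⌊ N ⌋
  ∼α⇒⌊⌋≡ (α-c k) = refl
  ∼α⇒⌊⌋≡ (α-v x) = refl
  ∼α⇒⌊⌋≡ (α-app M∼M' N∼N') = cong₂ _·_ (∼α⇒⌊⌋≡ M∼M') (∼α⇒⌊⌋≡ N∼N')
  ∼α⇒⌊⌋≡ (α-lam {M = M} {M'} y A∼A' y∉M y∉M' eq) =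
    cong₃ lam (binder-α M M' y y∉M y∉M' eq) (∼α⇒⌊⌋≡ A∼A') (body-α M M' y y∉M y∉M' eq)
  ∼α⇒⌊⌋≡ (α-pi {B = B} {B'} y A∼A' y∉B y∉B' eq) =
    cong₃ pi (binder-α B B' y y∉B y∉B' eq) (∼α⇒⌊⌋≡ A∼A') (body-α B B' y y∉B y∉B' eq)

  ⌊⌋-c : ∀ N {k} → ⌊ N ⌋ ≡ c k → N ≡ c k
  ⌊⌋-c (c _) refl = refl
  ⌊⌋-c (v _) ()
  ⌊⌋-c (lam _ _ _) ()
  ⌊⌋-c (pi _ _ _) ()
  ⌊⌋-c (_ · _) ()

  ⌊⌋-v : ∀ N {x} → ⌊ N ⌋ ≡ v x → N ≡ v x
  ⌊⌋-v (v _) refl = refl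
  ⌊⌋-v (c _) ()
  ⌊⌋-v (lam _ _ _) ()
  ⌊⌋-v (pi _ _ _) ()
  ⌊⌋-v (_ · _) ()

  ⌊⌋-lam : ∀ N {x A M} → ⌊ N ⌋ ≡ lam x A M → ∃[ x' ] ∃[ A' ] ∃[ M' ] N ≡ lam x' A' M'
  ⌊⌋-lam (lam x A M) _ = x , A , M , refl
  ⌊⌋-lam (c _) ()
  ⌊⌋-lam (v _) ()
  ⌊⌋-lam (pi _ _ _) ()
  ⌊⌋-lam (_ · _) ()

  ⌊⌋-pi : ∀ N {x A B} → ⌊ N ⌋ ≡ pi x A B → ∃[ x' ] ∃[ A' ] ∃[ B' ] N ≡ pi x' A' B'
  ⌊⌋-pi (pi x A B) _ = x , A , B , refl
  ⌊⌋-pi (c _) ()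
  ⌊⌋-pi (v _) ()
  ⌊⌋-pi (lam _ _ _) ()
  ⌊⌋-pi (_ · _) ()

  ⌊⌋-app : ∀ N {M₁ M₂} → ⌊ N ⌋ ≡ M₁ · M₂ → ∃[ N₁ ] ∃[ N₂ ] N ≡ N₁ · N₂
  ⌊⌋-app (N₁ · N₂) _ = N₁ , N₂ , refl
  ⌊⌋-app (c _) ()
  ⌊⌋-app (v _) ()
  ⌊⌋-app (lam _ _ _) ()
  ⌊⌋-app (pi _ _ _) ()

  lam-injective : ∀ {x x' A A' M M'} → lam x A M ≡ lam x' A' M' → x ≡ x' × A ≡ A' × M ≡ M'
  lam-injective refl = refl , refl , refl

  pi-injective : ∀ {x x' A A' B B'} → pi x A B ≡ pi x' A' B' → x ≡ x' × A ≡ A' × B ≡ B'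
  pi-injective refl = refl , refl , refl

  app-injective : ∀ {M M' N N'} → (M · N) ≡ (M' · N') → M ≡ M' × N ≡ N'
  app-injective refl = refl , refl

  ⌊⌋≡⇒∼α : ∀ M N → ⌊ M ⌋ ≡ ⌊ N ⌋ → M ∼α N
  ⌊⌋≡⇒∼α (c k) N eq with refl ← ⌊⌋-c N (sym eq) = α-c k
  ⌊⌋≡⇒∼α (v x) N eq with refl ← ⌊⌋-v N (sym eq) = α-v x
  ⌊⌋≡⇒∼α (M₁ · M₂) N eq with N₁ , N₂ , refl ← ⌊⌋-app N (sym eq) =
    let eq₁ , eq₂ = app-injective eq in α-app (⌊⌋≡⇒∼α M₁ N₁ eq₁) (⌊⌋≡⇒∼α M₂ N₂ eq₂)
  ⌊⌋≡⇒∼α (lam x A M) N eq with x' , A' , M' , refl ← ⌊⌋-lam N (sym eq) =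
    let eq₁ , eq₂ , eq₃ = lam-injective eq in
    α-lam (binder ι x M) (⌊⌋≡⇒∼α A A' eq₂) (binder-ι-∉ M x)
      (subst (_∉ fv M' - x') (sym eq₁) (binder-ι-∉ M' x'))
      (trans eq₃ (cong (λ w → M' [ x' ≔ v w ]) (sym eq₁)))
  ⌊⌋≡⇒∼α (pi x A B) N eq with x' , A' , B' , refl ← ⌊⌋-pi N (sym eq) =
    let eq₁ , eq₂ , eq₃ = pi-injective eq in
    α-pi (binder ι x B) (⌊⌋≡⇒∼α A A' eq₂) (binder-ι-∉ B x)
      (subst (_∉ fv B' - x') (sym eq₁) (binder-ι-∉ B' x'))
      (trans eq₃ (cong (λ w → B' [ x' ≔ v w ]) (sym eq₁)))

  -- Conversion under substitution

  minus-⊆ : ∀ {L L'} x → L ⊆ L' → L - x ⊆ L' - x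
  minus-⊆ {L} {L'} x L⊆L' u∈L-x = let u∈L , u≢x = ∈-minus⁻ L u∈L-x in ∈-minus⁺ L' (L⊆L' u∈L) u≢x

  →β-fv⊆ : ∀ {M N} → M →β N → fv N ⊆ fv M
  →β-fv⊆ (base (β {x} {A} {M} {N})) {u} u∈M[x≔N] =
    let w , w∈M , u∈w[x≔N] = find (∈-concatMap⁻ _ (subst (u ∈_) (fv-• M _) u∈M[x≔N])) in
    redex w w∈M u∈w[x≔N]
    where
    redex : ∀ w → w ∈ fv M → u ∈ fv ((ι ⟨ x ≔ N ⟩) w) → u ∈ fv (lam x A M · N)
    redex w w∈M u∈w[x≔N] with w ≟V x
    ... | yes _ = ∈-++⁺ʳ (fv A ++ (fv M - x)) u∈w[x≔N]
    ... | no w≢x with here refl ← u∈w[x≔N] = ∈-++⁺ˡ (∈-++⁺ʳ (fv A) (∈-minus⁺ (fv M) w∈M w≢x))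
  →β-fv⊆ (lam-body {x} {A} r) = ++⁺ʳ (fv A) (minus-⊆ x (→β-fv⊆ r))
  →β-fv⊆ (lam-ann {x} {M = M} r) = ++⁺ˡ (fv M - x) (→β-fv⊆ r)
  →β-fv⊆ (pi-cod {x} {A} r) = ++⁺ʳ (fv A) (minus-⊆ x (→β-fv⊆ r))
  →β-fv⊆ (pi-dom {x} {B = B} r) = ++⁺ˡ (fv B - x) (→β-fv⊆ r)
  →β-fv⊆ (app-l {N = N} r) = ++⁺ˡ (fv N) (→β-fv⊆ r)
  →β-fv⊆ (app-r {M} r) = ++⁺ʳ (fv M) (→β-fv⊆ r)

  ≃-α : ∀ {M N} → ⌊ M ⌋ ≡ ⌊ N ⌋ → M ≃β N
  ≃-α {M} {N} eq = step-α (⌊⌋≡⇒∼α M N eq)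

  ≃β-cong : (f : Term → Term) → (∀ {M N} → ⌊ M ⌋ ≡ ⌊ N ⌋ → ⌊ f M ⌋ ≡ ⌊ f N ⌋) →
            (∀ {M N} → M →β N → f M →β f N) → ∀ {M N} → M ≃β N → f M ≃β f N
  ≃β-cong f f-α f-β (step-α M∼N) = ≃-α (f-α (∼α⇒⌊⌋≡ M∼N))
  ≃β-cong f f-α f-β (step-β M→N) = step-β (f-β M→N)
  ≃β-cong f f-α f-β ≃-refl = ≃-refl
  ≃β-cong f f-α f-β (≃-sym N≃M) = ≃-sym (≃β-cong f f-α f-β N≃M)
  ≃β-cong f f-α f-β (≃-trans M≃K K≃N) = ≃-trans (≃β-cong f f-α f-β M≃K) (≃β-cong f f-α f-β K≃N)

  lam-body-≃β : ∀ x A {M M'} → M ≃β M' → lam x A M ≃β lam x A M'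
  lam-body-≃β x A = ≃β-cong (lam x A)
    (λ {M} {N} eq → cong₃ lam (binder-resp-⌊⌋ {M} {N} ι x eq) refl (body-resp-⌊⌋ {M} {N} ι x eq)) lam-body

  pi-cod-≃β : ∀ x A {B B'} → B ≃β B' → pi x A B ≃β pi x A B'
  pi-cod-≃β x A = ≃β-cong (pi x A)
    (λ {M} {N} eq → cong₃ pi (binder-resp-⌊⌋ {M} {N} ι x eq) refl (body-resp-⌊⌋ {M} {N} ι x eq)) pi-cod

  lam-ann-≃β : ∀ x M {A A'} → A ≃β A' → lam x A M ≃β lam x A' M
  lam-ann-≃β x M = ≃β-cong (λ A → lam x A M) (cong (λ A → lam _ A _)) lam-ann

  pi-dom-≃β : ∀ x B {A A'} → A ≃β A' → pi x A B ≃β pi x A' B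
  pi-dom-≃β x B = ≃β-cong (λ A → pi x A B) (cong (λ A → pi _ A _)) pi-dom

  app-l-≃β : ∀ N {M M'} → M ≃β M' → (M · N) ≃β (M' · N)
  app-l-≃β N = ≃β-cong (_· N) (cong (_· _)) app-l

  app-r-≃β : ∀ M {N N'} → N ≃β N' → (M · N) ≃β (M · N')
  app-r-≃β M = ≃β-cong (M ·_) (cong (_ ·_)) app-r

  body-substitute : ∀ B x {N N'} σ → Normal σ → ⌊ N' ⌋ ≡ N • σ →
                    ⌊ body σ x B [ binder σ x B ≔ N' ] ⌋ ≡ (B [ x ≔ N ]) • σ
  body-substitute B x {N} {N'} σ σ-normal N'≡Nσ = begin
    ⌊ body σ x B [ y ≔ N' ] ⌋                     ≡⟨ •-⨾ (body σ x B) _ ι ⟩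
    body σ x B • ((ι ⟨ y ≔ N' ⟩) ⨾ ι)             ≡⟨ •-⨾ B _ _ ⟩
    B • ((σ ⟨ x ≔ v y ⟩) ⨾ ((ι ⟨ y ≔ N' ⟩) ⨾ ι))  ≡⟨ •-cong B (λ {u} → pointwise u) ⟩
    B • ((ι ⟨ x ≔ N ⟩) ⨾ σ)                       ≡⟨ •-⨾ B _ σ ⟨
    (B [ x ≔ N ]) • σ                             ∎
    where
    open ≡-Reasoning
    y = binder σ x B
    pointwise : ∀ u → u ∈ fv B → ((σ ⟨ x ≔ v y ⟩) u) • ((ι ⟨ y ≔ N' ⟩) ⨾ ι) ≡ ((ι ⟨ x ≔ N ⟩) u) • σ
    pointwise u u∈B with u ≟V x
    ... | yes _ = trans (cong ⌊_⌋ (update-here ι y N')) N'≡Nσ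
    ... | no u≢x = begin
      σ u • ((ι ⟨ y ≔ N' ⟩) ⨾ ι)  ≡⟨ •-⨾ (σ u) _ ι ⟨
      ⌊ σ u [ y ≔ N' ] ⌋          ≡⟨ cong ⌊_⌋ (•-update-∉ (σ u) ι y N' (X-fresh σ (fv B - x) (∈-minus⁺ (fv B) u∈B u≢x))) ⟩
      ⌊ ⌊ σ u ⌋ ⌋                 ≡⟨ cong ⌊_⌋ (σ-normal u) ⟩
      ⌊ σ u ⌋                     ≡⟨ σ-normal u ⟩
      σ u                         ∎

  lam-rebind : ∀ x A M σ y → Normal σ → Fresh y σ (fv M - x) → ⌊ lam y (A • σ) (M • (σ ⟨ x ≔ v y ⟩)) ⌋ ≡ lam x A M • σ
  lam-rebind x A M σ y σ-normal y# =
    cong₃ lam (binder-rebind M x σ y y#) (⌊•⌋ A σ-normal) (body-rebind M x σ y σ-normal y#)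

  pi-rebind : ∀ x A B σ y → Normal σ → Fresh y σ (fv B - x) → ⌊ pi y (A • σ) (B • (σ ⟨ x ≔ v y ⟩)) ⌋ ≡ pi x A B • σ
  pi-rebind x A B σ y σ-normal y# =
    cong₃ pi (binder-rebind B x σ y y#) (⌊•⌋ A σ-normal) (body-rebind B x σ y σ-normal y#)

  →β-• : ∀ {M N} σ → Normal σ → M →β N → (M • σ) ≃β (N • σ)
  →β-• σ σ-normal (base (β {x} {M = M} {N})) =
    ≃-trans (step-β (base β)) (≃-α (trans (body-substitute M x σ σ-normal (⌊•⌋ N σ-normal)) (sym (⌊•⌋ (M [ x ≔ N ]) σ-normal))))
  →β-• σ σ-normal (lam-body {x} {A} {M} {M'} r) =
    ≃-trans (lam-body-≃β y (A • σ) (→β-• (σ ⟨ x ≔ v y ⟩) (update-normal x σ-normal refl) r))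
            (≃-α (trans (lam-rebind x A M' σ y σ-normal y#) (sym (⌊•⌋ (lam x A M') σ-normal))))
    where
    y = binder σ x M
    y# : Fresh y σ (fv M' - x)
    y# = X-fresh σ (fv M - x) ∘ minus-⊆ x (→β-fv⊆ r)
  →β-• σ σ-normal (pi-cod {x} {A} {B} {B'} r) =
    ≃-trans (pi-cod-≃β y (A • σ) (→β-• (σ ⟨ x ≔ v y ⟩) (update-normal x σ-normal refl) r))
            (≃-α (trans (pi-rebind x A B' σ y σ-normal y#) (sym (⌊•⌋ (pi x A B') σ-normal))))
    where
    y = binder σ x B
    y# : Fresh y σ (fv B' - x)
    y# = X-fresh σ (fv B - x) ∘ minus-⊆ x (→β-fv⊆ r)
  →β-• σ σ-normal (lam-ann r) = lam-ann-≃β _ _ (→β-• σ σ-normal r)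
  →β-• σ σ-normal (pi-dom r) = pi-dom-≃β _ _ (→β-• σ σ-normal r)
  →β-• σ σ-normal (app-l r) = app-l-≃β _ (→β-• σ σ-normal r)
  →β-• σ σ-normal (app-r r) = app-r-≃β _ (→β-• σ σ-normal r)

  ≃β-• : ∀ {A B} σ → Normal σ → A ≃β B → (A • σ) ≃β (B • σ)
  ≃β-• σ σ-normal (step-α {A} {B} A∼B) = ≃-α (cong ⌊_⌋ (•-resp-⌊⌋ {A} {B} σ (∼α⇒⌊⌋≡ A∼B)))
  ≃β-• σ σ-normal (step-β A→B) = →β-• σ σ-normal A→B
  ≃β-• σ σ-normal ≃-refl = ≃-refl
  ≃β-• σ σ-normal (≃-sym B≃A) = ≃-sym (≃β-• σ σ-normal B≃A)
  ≃β-• σ σ-normal (≃-trans A≃C C≃B) = ≃-trans (≃β-• σ σ-normal A≃C) (≃β-• σ σ-normal C≃B)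

  -- Basic properties of the infinitary system

  ⊢⇒Ok : ∀ {Γ M T} → Γ ⊢ M ∶ T → Ok Γ
  ⊢⇒Ok (t-sort ok _) = ok
  ⊢⇒Ok (t-prod dA _ _) = ⊢⇒Ok dA
  ⊢⇒Ok (t-var ok _) = ok
  ⊢⇒Ok (t-abs dA _ _ _) = ⊢⇒Ok dA
  ⊢⇒Ok (t-app dM _ _) = ⊢⇒Ok dM
  ⊢⇒Ok (t-conv dM _ _) = ⊢⇒Ok dM

  ∈⇒∈-dom : ∀ {Γ x A} → (x , A) ∈ Γ → x ∈ dom Γ
  ∈⇒∈-dom = ∈-map⁺ proj₁

  weaken : ∀ {Γ Δ M T} → Γ ⊢ M ∶ T → Γ ⊆ Δ → Ok Δ → Δ ⊢ M ∶ T
  weaken (t-sort _ ax) Γ⊆Δ okΔ = t-sort okΔ ax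
  weaken (t-prod dA dB r) Γ⊆Δ okΔ =
    t-prod dA' (λ y y∉Δ → weaken (dB y (y∉Δ ∘ map⁺ proj₁ Γ⊆Δ)) (∷⁺ʳ _ Γ⊆Δ) (ok-cons okΔ dA' y∉Δ)) r
    where dA' = weaken dA Γ⊆Δ okΔ
  weaken (t-var _ x∈Γ) Γ⊆Δ okΔ = t-var okΔ (Γ⊆Δ x∈Γ)
  weaken (t-abs dA dB dM r) Γ⊆Δ okΔ =
    t-abs dA' (λ z z∉Δ → weaken (dB z (z∉Δ ∘ map⁺ proj₁ Γ⊆Δ)) (∷⁺ʳ _ Γ⊆Δ) (ok-cons okΔ dA' z∉Δ))
              (λ z z∉Δ → weaken (dM z (z∉Δ ∘ map⁺ proj₁ Γ⊆Δ)) (∷⁺ʳ _ Γ⊆Δ) (ok-cons okΔ dA' z∉Δ)) r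
    where dA' = weaken dA Γ⊆Δ okΔ
  weaken (t-app dM dN dB) Γ⊆Δ okΔ = t-app (weaken dM Γ⊆Δ okΔ) (weaken dN Γ⊆Δ okΔ) (weaken dB Γ⊆Δ okΔ)
  weaken (t-conv dM A≃B dB) Γ⊆Δ okΔ = t-conv (weaken dM Γ⊆Δ okΔ) A≃B (weaken dB Γ⊆Δ okΔ)

  ∈-fv-rename : ∀ B x y {u} → u ∈ fv B - x → u ∈ fv (B [ x ≔ v y ])
  ∈-fv-rename B x y {u} u∈B-x = let u∈B , u≢x = ∈-minus⁻ (fv B) u∈B-x in
    subst (u ∈_) (sym (fv-• B _))
      (∈-concatMap⁺ _ (lose u∈B (subst (λ T → u ∈ fv T) (sym (update-there ι x (v y) u≢x)) (here refl))))

  -- Instantiate the binder with a name fresh for u as well, so that u cannot be that name.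
  fv-binder⊆dom : ∀ {Γ} B x → (∀ y → y ∉ dom Γ → fv (B [ x ≔ v y ]) ⊆ y ∷ dom Γ) → fv B - x ⊆ dom Γ
  fv-binder⊆dom {Γ} B x fv⊆ {u} u∈B-x with fv⊆ y (X'-fresh (u ∷ dom Γ) ∘ there) (∈-fv-rename B x y u∈B-x)
    where y = X' (u ∷ dom Γ)
  ... | here u≡y = ⊥-elim (X'-fresh (u ∷ dom Γ) (here (sym u≡y)))
  ... | there u∈Γ = u∈Γ

  fv⊆dom : ∀ {Γ M T} → Γ ⊢ M ∶ T → fv M ⊆ dom Γ
  fv⊆dom (t-sort _ _) ()
  fv⊆dom (t-prod {x = x} {A} {B} dA dB _) u∈Π with ∈-++⁻ (fv A) u∈Π
  ... | inj₁ u∈A = fv⊆dom dA u∈A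
  ... | inj₂ u∈B = fv-binder⊆dom B x (λ y y∉Γ → fv⊆dom (dB y y∉Γ)) u∈B
  fv⊆dom (t-var _ x∈Γ) (here refl) = ∈⇒∈-dom x∈Γ
  fv⊆dom (t-abs {x = x} {A = A} {M = M} dA _ dM _) u∈λ with ∈-++⁻ (fv A) u∈λ
  ... | inj₁ u∈A = fv⊆dom dA u∈A
  ... | inj₂ u∈M = fv-binder⊆dom M x (λ z z∉Γ → fv⊆dom (dM z z∉Γ)) u∈M
  fv⊆dom (t-app {M = M} dM dN _) u∈MN with ∈-++⁻ (fv M) u∈MN
  ... | inj₁ u∈M = fv⊆dom dM u∈M
  ... | inj₂ u∈N = fv⊆dom dN u∈N
  fv⊆dom (t-conv dM _ _) = fv⊆dom dM

  entry-fv⊆dom : ∀ {Γ x A} → Ok Γ → (x , A) ∈ Γ → fv A ⊆ dom Γ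
  entry-fv⊆dom (ok-cons _ dA _) (here refl) = there ∘ fv⊆dom dA
  entry-fv⊆dom (ok-cons ok _ _) (there x∈Γ) = there ∘ entry-fv⊆dom ok x∈Γ

  entry-typed : ∀ {Γ x A} → Ok Γ → (x , A) ∈ Γ → ∃[ s ] Γ ⊢ A ∶ c s
  entry-typed ok@(ok-cons {s = s} _ dA _) (here refl) = s , weaken dA there ok
  entry-typed ok@(ok-cons ok' _ _) (there x∈Γ) = let s , dA = entry-typed ok' x∈Γ in s , weaken dA there ok

  ⊢pi-inv : ∀ {Γ x A B T} → Γ ⊢ pi x A B ∶ T →
            ∃[ s₁ ] ∃[ s₂ ] Γ ⊢ A ∶ c s₁ × (∀ y → y ∉ dom Γ → ((y , A) ∷ Γ) ⊢ B [ x ≔ v y ] ∶ c s₂)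
  ⊢pi-inv (t-prod {s₁ = s₁} {s₂} dA dB _) = s₁ , s₂ , dA , dB
  ⊢pi-inv (t-conv dΠ _ _) = ⊢pi-inv dΠ

  type-valid : ∀ {Γ M T} → Γ ⊢ M ∶ T → (∃[ s ] T ≡ c s) ⊎ (∃[ s ] Γ ⊢ T ∶ c s)
  type-valid (t-sort _ _) = inj₁ (_ , refl)
  type-valid (t-prod _ _ _) = inj₁ (_ , refl)
  type-valid (t-var ok x∈Γ) = inj₂ (entry-typed ok x∈Γ)
  type-valid (t-abs dA dB _ r) = inj₂ (_ , t-prod dA dB r)
  type-valid (t-app _ _ dB) = inj₂ (_ , dB)
  type-valid (t-conv _ _ dB) = inj₂ (_ , dB)

  -- The substitution lemma

  -- Typing rules mention arbitrary α-variants of substituted terms (e.g. `B [ x ≔ v z ]`), so σ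
  -- must type every α-variant of `σ x`, and the substitution lemma types every α-variant of `M • σ`.
  record _∶_⇒_ (σ : Subst) (Γ Δ : Context) : Set where
    field
      target-ok : Ok Δ
      normal    : Normal σ
      typed     : ∀ {x A} → (x , A) ∈ Γ → ∀ N → ⌊ N ⌋ ≡ σ x → ∃[ A' ] ⌊ A' ⌋ ≡ A • σ × Δ ⊢ N ∶ A'
  open _∶_⇒_

  ⇒-tail : ∀ {σ p Γ Δ} → σ ∶ (p ∷ Γ) ⇒ Δ → σ ∶ Γ ⇒ Δ
  ⇒-tail σ⇒ = record { target-ok = target-ok σ⇒ ; normal = normal σ⇒ ; typed = typed σ⇒ ∘ there }

  ι-⇒ : ∀ {Γ} → Ok Γ → ι ∶ Γ ⇒ Γ
  ι-⇒ {Γ} okΓ = record { target-ok = okΓ ; normal = ι-normal ; typed = typed-ι }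
    where
    typed-ι : ∀ {x A} → (x , A) ∈ Γ → ∀ N → ⌊ N ⌋ ≡ v x → ∃[ A' ] ⌊ A' ⌋ ≡ ⌊ A ⌋ × Γ ⊢ N ∶ A'
    typed-ι {A = A} x∈Γ N N≡x with refl ← ⌊⌋-v N N≡x = A , refl , t-var okΓ x∈Γ

  ⇒-extend : ∀ {σ Γ Δ w z A A' s s'} → σ ∶ Γ ⇒ Δ → Γ ⊢ A ∶ c s → w ∉ dom Γ →
             Δ ⊢ A' ∶ c s' → ⌊ A' ⌋ ≡ A • σ → z ∉ dom Δ →
             (σ ⟨ w ≔ v z ⟩) ∶ ((w , A) ∷ Γ) ⇒ ((z , A') ∷ Δ)
  ⇒-extend {σ} {Γ} {Δ} {w} {z} {A} {A'} σ⇒ dA w∉Γ dA' A'≡Aσ z∉Δ = record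
    { target-ok = okΔ'
    ; normal = update-normal w (normal σ⇒) refl
    ; typed = typed' }
    where
    okΔ' = ok-cons (target-ok σ⇒) dA' z∉Δ
    σ' = σ ⟨ w ≔ v z ⟩
    typed' : ∀ {x B} → (x , B) ∈ (w , A) ∷ Γ → ∀ N → ⌊ N ⌋ ≡ σ' x → ∃[ B' ] ⌊ B' ⌋ ≡ B • σ' × ((z , A') ∷ Δ) ⊢ N ∶ B'
    typed' (here refl) N N≡z with refl ← ⌊⌋-v N (trans N≡z (update-here σ w (v z))) =
      A' , trans A'≡Aσ (sym (•-update-∉ A σ w (v z) (w∉Γ ∘ fv⊆dom dA))) , t-var okΔ' (here refl)
    typed' {x} {B} (there x∈Γ) N N≡σ'x =
      let B' , B'≡Bσ , dN = typed σ⇒ x∈Γ N (trans N≡σ'x (update-there σ w (v z) x≢w)) in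
      B' , trans B'≡Bσ (sym (•-update-∉ B σ w (v z) (w∉Γ ∘ entry-fv⊆dom (⊢⇒Ok dA) x∈Γ))) , weaken dN there okΔ'
      where
      x≢w : x ≢ w
      x≢w x≡w = w∉Γ (subst (_∈ dom Γ) x≡w (∈⇒∈-dom x∈Γ))

  mutual
    substitution : ∀ {Γ Δ M T σ} → Γ ⊢ M ∶ T → σ ∶ Γ ⇒ Δ → ∀ M' → ⌊ M' ⌋ ≡ M • σ → Δ ⊢ M' ∶ T • σ
    substitution (t-sort _ ax) σ⇒ M' eq with refl ← ⌊⌋-c M' eq = t-sort (target-ok σ⇒) ax
    substitution (t-var {A = A} okΓ x∈Γ) σ⇒ M' eq =
      let A' , A'≡Aσ , dM' = typed σ⇒ x∈Γ M' eq
          _ , dAσ = entry-substituted okΓ σ⇒ x∈Γ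
      in t-conv dM' (≃-α (trans A'≡Aσ (sym (⌊•⌋ A (normal σ⇒))))) dAσ
    substitution (t-conv {B = B} dM A≃B dB) σ⇒ M' eq =
      t-conv (substitution dM σ⇒ M' eq) (≃β-• _ (normal σ⇒) A≃B) (substitution dB σ⇒ _ (⌊•⌋ B (normal σ⇒)))
    substitution (t-prod {x = x} {A} {B} dA dB r) σ⇒ M' eq with x' , A' , B' , refl ← ⌊⌋-pi M' eq =
      let eq₁ , eq₂ , eq₃ = pi-injective eq
          dA' = substitution dA σ⇒ A' eq₂
      in t-prod dA' (λ z z∉Δ → substitution-under-binder x B dB dA σ⇒ dA' eq₂ [] (λ _ _ → refl) z∉Δ
                                 (B' [ x' ≔ v z ]) (instantiate-⌊⌋ B' B eq₁ eq₃ (normal σ⇒) z)) r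
    substitution {Δ = Δ} {σ = σ} (t-abs {x = x} {y} {A} {B} {M} {s₂ = s₂} dA dB dM r) σ⇒ M' eq
      with x' , A' , M₀ , refl ← ⌊⌋-lam M' eq =
      t-conv (t-abs {y = y₁} {B = D} dA' (dD dA' eq₂) dM₀ r)
             (pi-dom-≃β y₁ D (≃-α (trans eq₂ (sym (⌊•⌋ A σ-normal)))))
             (t-prod dAσ (dD dAσ (⌊•⌋ A σ-normal)) r)
      where
      σ-normal = normal σ⇒
      y₁ = binder σ y B
      D = body σ y B
      eq₁ = proj₁ (lam-injective eq)
      eq₂ = proj₁ (proj₂ (lam-injective eq))
      eq₃ = proj₂ (proj₂ (lam-injective eq))
      dA' = substitution dA σ⇒ A' eq₂
      dAσ = substitution dA σ⇒ (A • σ) (⌊•⌋ A σ-normal)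
      D-instance : ∀ z → B • (σ ⟨ y ≔ v z ⟩) ≡ D [ y₁ ≔ v z ]
      D-instance z = sym (•-update-rename B y σ z σ-normal (X-fresh σ (fv B - y)))
      dD : ∀ {A'' s} → Δ ⊢ A'' ∶ c s → ⌊ A'' ⌋ ≡ A • σ → ∀ z → z ∉ dom Δ → ((z , A'') ∷ Δ) ⊢ D [ y₁ ≔ v z ] ∶ c s₂
      dD dA'' A''≡Aσ z z∉Δ = substitution-under-binder y B dB dA σ⇒ dA'' A''≡Aσ [] (λ _ _ → refl) z∉Δ
        (D [ y₁ ≔ v z ]) (trans (⌊•⌋ D (rename-normal y₁ z)) (sym (D-instance z)))
      dM₀ : ∀ z → z ∉ dom Δ → ((z , A') ∷ Δ) ⊢ M₀ [ x' ≔ v z ] ∶ D [ y₁ ≔ v z ]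
      dM₀ z z∉Δ = substitution-under-binder x M dM dA σ⇒ dA' eq₂ (fv B - y)
        (λ w w∉B → trans (sym (•-rename B σ (v z) w∉B)) (D-instance z)) z∉Δ
        (M₀ [ x' ≔ v z ]) (instantiate-⌊⌋ M₀ M eq₁ eq₃ σ-normal z)
    substitution (t-app {x = x} {B = B} dM dN dB) σ⇒ M' eq with M₁ , N₁ , refl ← ⌊⌋-app M' eq =
      let eq₁ , eq₂ = app-injective eq
          B-instance = body-substitute B x _ (normal σ⇒) eq₂
      in t-conv (t-app (substitution dM σ⇒ M₁ eq₁) (substitution dN σ⇒ N₁ eq₂) (substitution dB σ⇒ _ B-instance))
                (≃-α (trans B-instance (sym (⌊•⌋ (B [ x ≔ _ ]) (normal σ⇒)))))
                (substitution dB σ⇒ _ (⌊•⌋ (B [ x ≔ _ ]) (normal σ⇒)))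

    entry-substituted : ∀ {Γ Δ σ x A} → Ok Γ → σ ∶ Γ ⇒ Δ → (x , A) ∈ Γ → ∃[ s ] Δ ⊢ A • σ ∶ c s
    entry-substituted {σ = σ} (ok-cons {A = A} {s} _ dA _) σ⇒ (here refl) =
      s , substitution dA (⇒-tail σ⇒) (A • σ) (⌊•⌋ A (normal σ⇒))
    entry-substituted (ok-cons okΓ _ _) σ⇒ (there x∈Γ) = entry-substituted okΓ (⇒-tail σ⇒) x∈Γ

    -- The premise is used at one name w fresh for Γ, B and `avoid`, outside of which T w • … is U.
    substitution-under-binder :
      ∀ {Γ Δ σ A A' s s' z U} {T : V → Term} x B →
      (∀ w → w ∉ dom Γ → ((w , A) ∷ Γ) ⊢ B [ x ≔ v w ] ∶ T w) →
      Γ ⊢ A ∶ c s → σ ∶ Γ ⇒ Δ → Δ ⊢ A' ∶ c s' → ⌊ A' ⌋ ≡ A • σ →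
      (avoid : List V) → (∀ w → w ∉ avoid → T w • (σ ⟨ w ≔ v z ⟩) ≡ U) → z ∉ dom Δ →
      ∀ B' → ⌊ B' ⌋ ≡ B • (σ ⟨ x ≔ v z ⟩) → ((z , A') ∷ Δ) ⊢ B' ∶ U
    substitution-under-binder {Γ} {σ = σ} {z = z} x B dB dA σ⇒ dA' A'≡Aσ avoid T≡U z∉Δ B' B'≡B =
      subst (_ ⊢ B' ∶_) (T≡U w w∉avoid)
        (substitution (dB w w∉Γ) (⇒-extend σ⇒ dA w∉Γ dA' A'≡Aσ z∉Δ) B' (trans B'≡B (•-rename B σ (v z) w∉B)))
      where
      w = X' (dom Γ ++ fv B ++ avoid)
      w∉Γ : w ∉ dom Γ
      w∉Γ = X'-fresh _ ∘ ∈-++⁺ˡ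
      w∉B : w ∉ fv B - x
      w∉B = X'-fresh _ ∘ ∈-++⁺ʳ (dom Γ) ∘ ∈-++⁺ˡ ∘ proj₁ ∘ ∈-minus⁻ (fv B)
      w∉avoid : w ∉ avoid
      w∉avoid = X'-fresh _ ∘ ∈-++⁺ʳ (dom Γ) ∘ ∈-++⁺ʳ (fv B)

  ⇒-single : ∀ {Γ N A s z} → Γ ⊢ N ∶ A → Γ ⊢ A ∶ c s → z ∉ dom Γ → (ι ⟨ z ≔ ⌊ N ⌋ ⟩) ∶ ((z , A) ∷ Γ) ⇒ Γ
  ⇒-single {Γ} {N} {A} {z = z} dN dA z∉Γ = record
    { target-ok = okΓ
    ; normal = update-normal z ι-normal (⌊⌊⌋⌋ N)
    ; typed = typed' }
    where
    okΓ = ⊢⇒Ok dN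
    σ = ι ⟨ z ≔ ⌊ N ⌋ ⟩
    ⌊⌋≡•σ : ∀ B → fv B ⊆ dom Γ → ⌊ B ⌋ ≡ B • σ
    ⌊⌋≡•σ B B⊆Γ = sym (•-update-∉ B ι z ⌊ N ⌋ (z∉Γ ∘ B⊆Γ))
    typed' : ∀ {x B} → (x , B) ∈ (z , A) ∷ Γ → ∀ N' → ⌊ N' ⌋ ≡ σ x → ∃[ B' ] ⌊ B' ⌋ ≡ B • σ × Γ ⊢ N' ∶ B'
    typed' (here refl) N' N'≡N =
      ⌊ A ⌋ , trans (⌊⌊⌋⌋ A) (⌊⌋≡•σ A (fv⊆dom dA)) ,
      substitution dN (ι-⇒ okΓ) N' (trans N'≡N (update-here ι z ⌊ N ⌋))
    typed' {x} {B} (there x∈Γ) N' N'≡x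
      with refl ← ⌊⌋-v N' (trans N'≡x (update-there ι z ⌊ N ⌋ (λ x≡z → z∉Γ (subst (_∈ dom Γ) x≡z (∈⇒∈-dom x∈Γ))))) =
      B , ⌊⌋≡•σ B (entry-fv⊆dom okΓ x∈Γ) , t-var okΓ x∈Γ

  ⊢-instantiate : ∀ {Γ N A s₁ s} x B → Γ ⊢ N ∶ A → Γ ⊢ A ∶ c s₁ →
                  (∀ z → z ∉ dom Γ → ((z , A) ∷ Γ) ⊢ B [ x ≔ v z ] ∶ c s) → Γ ⊢ B [ x ≔ N ] ∶ c s
  ⊢-instantiate {Γ} {N} x B dN dA dB =
    substitution (dB z z∉Γ) (⇒-single dN dA z∉Γ) (B [ x ≔ N ]) (begin
      ⌊ B [ x ≔ N ] ⌋                    ≡⟨ •-⨾ B _ ι ⟩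
      B • ((ι ⟨ x ≔ N ⟩) ⨾ ι)            ≡⟨ •-cong B (λ {u} _ → ⌊⌋-update u) ⟩
      B • (ι ⟨ x ≔ ⌊ N ⌋ ⟩)              ≡⟨ •-rename B ι ⌊ N ⌋ z∉B ⟩
      (B [ x ≔ v z ]) • (ι ⟨ z ≔ ⌊ N ⌋ ⟩) ∎)
    where
    open ≡-Reasoning
    z = X' (dom Γ ++ fv B)
    z∉Γ : z ∉ dom Γ
    z∉Γ = X'-fresh _ ∘ ∈-++⁺ˡ
    z∉B : z ∉ fv B - x
    z∉B = X'-fresh _ ∘ ∈-++⁺ʳ (dom Γ) ∘ proj₁ ∘ ∈-minus⁻ (fv B)
    ⌊⌋-update : ∀ u → ⌊ (ι ⟨ x ≔ N ⟩) u ⌋ ≡ (ι ⟨ x ≔ ⌊ N ⌋ ⟩) u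
    ⌊⌋-update u with u ≟V x
    ... | yes _ = refl
    ... | no _ = refl

  rename-fresh : ∀ {Γ A y z T} M x → ((y , A) ∷ Γ) ⊢ M [ x ≔ v y ] ∶ T → y ∉ fv M - x → z ∉ dom Γ →
                 ((z , A) ∷ Γ) ⊢ M [ x ≔ v z ] ∶ T [ y ≔ v z ]
  rename-fresh {z = z} M x dM y∉M z∉Γ with ok-cons okΓ dA y∉Γ ← ⊢⇒Ok dM =
    substitution dM (⇒-extend (ι-⇒ okΓ) dA y∉Γ dA refl z∉Γ) (M [ x ≔ v z ])
      (trans (⌊•⌋ M (rename-normal x z)) (•-rename M ι (v z) y∉M))

  -- From the standard to the infinitary system

  mutual
    okₛ⇒ok : ∀ {Γ} → Okₛ Γ → Ok Γ
    okₛ⇒ok ok-nil = ok-nil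
    okₛ⇒ok (ok-cons okΓ dA x∉Γ) = ok-cons (okₛ⇒ok okΓ) (⊢ₛ⇒⊢ dA) x∉Γ

    ⊢ₛ⇒⊢ : ∀ {Γ M T} → Γ ⊢ₛ M ∶ T → Γ ⊢ M ∶ T
    ⊢ₛ⇒⊢ (t-sort okΓ ax) = t-sort (okₛ⇒ok okΓ) ax
    ⊢ₛ⇒⊢ (t-prod {x = x} {B = B} dA dB r y∉B) = t-prod (⊢ₛ⇒⊢ dA) (λ _ z∉Γ → rename-fresh B x (⊢ₛ⇒⊢ dB) y∉B z∉Γ) r
    ⊢ₛ⇒⊢ (t-var okΓ x∈Γ) = t-var (okₛ⇒ok okΓ) x∈Γ
    ⊢ₛ⇒⊢ (t-abs {x = x} {y} {B = B} {M} dA dB dM r z∉M z∉B) =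
      t-abs (⊢ₛ⇒⊢ dA) (λ _ w∉Γ → rename-fresh B y (⊢ₛ⇒⊢ dB) z∉B w∉Γ)
        (λ w w∉Γ → subst (_ ⊢ _ ∶_) (sym (•-rename B ι (v w) z∉B)) (rename-fresh M x (⊢ₛ⇒⊢ dM) z∉M w∉Γ)) r
    ⊢ₛ⇒⊢ (t-app {x = x} {B = B} dM dN) with type-valid (⊢ₛ⇒⊢ dM)
    ... | inj₁ (_ , ())
    ... | inj₂ (_ , dΠ) =
      let _ , _ , dA , dB = ⊢pi-inv dΠ
          dN' = ⊢ₛ⇒⊢ dN
      in t-app (⊢ₛ⇒⊢ dM) dN' (⊢-instantiate x B dN' dA dB)
    ⊢ₛ⇒⊢ (t-conv dM A≃B dB) = t-conv (⊢ₛ⇒⊢ dM) A≃B (⊢ₛ⇒⊢ dB)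

theorem4 : (P : Params) → let open System P in
           (∀ Γ → Okₛ Γ → Ok Γ) × (∀ Γ M A → Γ ⊢ₛ M ∶ A → Γ ⊢ M ∶ A)
theorem4 P = (λ _ → okₛ⇒ok) , (λ _ _ _ → ⊢ₛ⇒⊢)
  where open Metatheory P
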